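{- Let $k\ge 1$ be a fixed integer, and for each $n$ let $\mathcal T_{n,k}$ denote the family of labeled graphs on vertex set $\{1,\dots,n\}$ that are $(k,t)$-threshold-PCGs for some integer $t$ with $1\le t\le k$. Then \[\frac{|\mathcal T_{n,k}|}{2^{\binom n2}}\to 0 \quad\text{as } n\to\infty.\]
   Context: All graphs are finite, simple and undirected; labeled graphs on $\{1,\dots,n\}$ are distinguished by their edge sets (there are $2^{\binom n2}$ of them). For an edge-weighted tree $T$ (nonnegative real edge weights) and leaves $x,y$, $d_T(x,y)$ is the sum of the weights on the unique $x$–$y$ path; $L(T)$ is the leaf set. A graph $G=(V,E)$ is a PCG if there exist an edge-weighted tree $T$, reals $0\le d_{\min}\le d_{\max}$ and a bijection $\zeta:V\to L(T)$ such that for all distinct $u,v\in V$: $uv\in E \iff d_{\min}\le d_T(\zeta(u),\zeta(v))\le d_{\max}$. For integers $1\le t\le k$, $G=(V,E)$ is a $(k,t)$-threshold-PCG if there exist PCGs $G_1=(V,E_1),\dots,G_k=(V,E_k)$ on the same vertex set such that for all distinct $u,v\in V$: $uv\in E \iff |\{i\in\{1,\dots,k\}: uv\in E_i\}|\ge t$.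
   Formalization: The edge weights of the trees and the distance bounds $d_{\min}$ and $d_{\max}$ of every PCG are rational numbers rather than reals. -}

module Defs where

open import Data.Nat as ℕ using (ℕ; zero; suc)
open import Data.Bool using (Bool; true; false; if_then_else_)
open import Data.Fin using (Fin; zero; suc)
open import Data.List using (List; []; _∷_; length)
open import Data.List.Relation.Unary.Unique.Propositional using (Unique)
open import Data.List.Relation.Unary.AllPairs using (AllPairs)
open import Data.List.Relation.Unary.All using (All)
open import Data.Rational as ℚ using (ℚ; 0ℚ)
open import Data.Product using (Σ; ∃; _×_; _,_)
open import Relation.Binary.PropositionalEquality using (_≡_; _≢_)
open import Relation.Nullary using (¬_)
open import Function using (_⇔_)
open import Function.Definitions using (Injective)

Graph : ℕ → Set
Graph n = Fin n → Fin n → Bool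

IsSimple : ∀ {n} → Graph n → Set
IsSimple {n} G = (∀ (u v : Fin n) → G u v ≡ G v u) × (∀ (u : Fin n) → G u u ≡ false)

SameGraph : ∀ {n} → Graph n → Graph n → Set
SameGraph {n} G H = ∀ (u v : Fin n) → u ≢ v → G u v ≡ H u v

data Walk {m : ℕ} (adj : Graph m) : Fin m → Fin m → Set where
  here : ∀ u → Walk adj u u
  step : ∀ {u w v} → adj u w ≡ true → Walk adj w v → Walk adj u v

verts : ∀ {m} {adj : Graph m} {u v} → Walk adj u v → List (Fin m)
verts (here u) = u ∷ []
verts (step {u = u} _ p) = u ∷ verts p

IsPath : ∀ {m} {adj : Graph m} {u v} → Walk adj u v → Set
IsPath p = Unique (verts p)

walkWeight : ∀ {m} {adj : Graph m} (w : Fin m → Fin m → ℚ) {u v} → Walk adj u v → ℚ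
walkWeight w (here u) = 0ℚ
walkWeight w (step {u = u} {w = x} _ p) = w u x ℚ.+ walkWeight w p

HasCycle : ∀ {m} → Graph m → Set
HasCycle {m} adj = Σ (Fin m) λ u → Σ (Fin m) λ v → Σ (Walk adj u v) λ p →
  IsPath p × (3 ℕ.≤ length (verts p)) × (adj v u ≡ true)

record WTree (m : ℕ) : Set where
  field
    adj       : Graph m
    simple    : IsSimple adj
    connected : ∀ (u v : Fin m) → Walk adj u v
    acyclic   : ¬ HasCycle adj
    weight    : Fin m → Fin m → ℚ
    weightSym : ∀ (u v : Fin m) → weight u v ≡ weight v u
    weightNonneg : ∀ (u v : Fin m) → adj u v ≡ true → 0ℚ ℚ.≤ weight u v

IsLeaf : ∀ {m} → WTree m → Fin m → Set
IsLeaf {m} T v = Σ (Fin m) λ w → (WTree.adj T v w ≡ true) ×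
  (∀ (w' : Fin m) → WTree.adj T v w' ≡ true → w' ≡ w)

-- d_T(x,y) is the weight of the unique x–y path in T; we quantify over all
-- paths from x to y (there is exactly one in a tree).
IsPCG : ∀ {n} → Graph n → Set
IsPCG {n} G =
  Σ ℕ λ m → Σ (WTree m) λ T → Σ ℚ λ dmin → Σ ℚ λ dmax → Σ (Fin n → Fin m) λ ζ →
    (0ℚ ℚ.≤ dmin) × (dmin ℚ.≤ dmax) ×
    Injective _≡_ _≡_ ζ × (∀ (x : Fin n) → IsLeaf T (ζ x)) ×
    (∀ (v : Fin m) → IsLeaf T v → Σ (Fin n) λ x → ζ x ≡ v) ×
    (∀ (x y : Fin n) → x ≢ y → (p : Walk (WTree.adj T) (ζ x) (ζ y)) → IsPath p →
       ((G x y ≡ true) ⇔ ((dmin ℚ.≤ walkWeight (WTree.weight T) p) ×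
                           (walkWeight (WTree.weight T) p ℚ.≤ dmax))))

countEdge : ∀ {n} (k : ℕ) → (Fin k → Graph n) → Fin n → Fin n → ℕ
countEdge zero Gs u v = 0
countEdge (suc k) Gs u v =
  (if Gs zero u v then 1 else 0) ℕ.+ countEdge k (λ i → Gs (suc i)) u v

IsThresholdPCG : ∀ {n} (k t : ℕ) → Graph n → Set
IsThresholdPCG {n} k t G =
  Σ (Fin k → Graph n) λ Gs →
    (∀ (i : Fin k) → IsSimple (Gs i) × IsPCG (Gs i)) ×
    (∀ (u v : Fin n) → u ≢ v → ((G u v ≡ true) ⇔ (t ℕ.≤ countEdge k Gs u v)))

InT : ∀ (n k : ℕ) → Graph n → Set
InT n k G = IsSimple G × Σ ℕ λ t → (1 ℕ.≤ t) × (t ℕ.≤ k) × IsThresholdPCG k t G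

DistinctMembers : ∀ (n k : ℕ) → List (Graph n) → Set
DistinctMembers n k Gs =
  All (InT n k) Gs × AllPairs (λ G H → ¬ SameGraph G H) Gs

-- A PCG on n vertices is determined by O(n log² n) bits, so there are at most 2^O(k n log² n) graphs
-- that are thresholds of k PCGs, which is o(2^(n choose 2)). The bits come from a centroid decomposition
-- of the tree: if c is a centroid of the current vertex set and x, y lie in different branches at c,
-- then d(x, y) = h x + h y with h = d(c, ·), so xy is an edge iff #{z | h x + h z < dmin} ≤ rank of h y
-- < #{z | h x + h z ≤ dmax}. These two counts, the rank of h x and a representative of the branch of x
-- make up a label of O(log n) bits; vertices in a common branch are separated recursively inside it,
-- and since a branch at a centroid holds at most half of the vertices, log n levels suffice.

module Submission where

open import Defs
open import Level using (0ℓ)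
open import Data.Nat as ℕ using (ℕ; zero; suc; z≤n; s≤s; _+_; _*_; _^_; _≤_; _<_)
open import Data.Nat.Properties as ℕ
  using (≤-refl; ≤-trans; <-≤-trans; ≤-<-trans; m≤n⇒m≤1+n; <⇒≱; ≮⇒≥; +-suc; +-mono-≤; +-mono-<;
         *-monoʳ-≤; *-mono-≤)
open import Data.Nat.Combinatorics using (_C_; nC1≡n; nCk+nC[k+1]≡[n+1]C[k+1])
open import Data.Bool as Bool using (Bool; true; false; if_then_else_)
open import Data.Bool.Properties using (T-≡)
open import Data.Fin as Fin using (Fin; zero; suc; toℕ)
open import Data.Fin.Properties as Fin using (_≟_)
open import Data.Rational as ℚ using (ℚ)
import Data.Rational.Properties as ℚ
open import Data.List as List using (List; []; _∷_; length)
open import Data.List.Membership.Propositional using (_∈_; _∉_)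
import Data.List.Relation.Binary.Subset.Propositional as List
open import Data.List.Relation.Unary.Any using (here; there; any?)
open import Data.List.Relation.Unary.All.Properties using (anti-mono; ¬Any⇒All¬)
open import Data.List.Relation.Unary.All as All using (All; []; _∷_)
open import Data.List.Membership.Propositional.Properties using (∈-lookup)
open import Data.List.Relation.Unary.AllPairs using (AllPairs; []; _∷_)
open import Data.List.Relation.Unary.Unique.Propositional.Properties using (Unique[x∷xs]⇒x∉xs)
open import Data.Maybe using (Maybe; just; nothing)
open import Data.Maybe.Properties using (just-injective) renaming (≡-dec to ≡-decᴹ)
open import Data.Sum using (_⊎_; inj₁; inj₂)
open import Data.Product using (Σ; ∃; _×_; _,_; proj₁; proj₂; uncurry)
open import Data.Unit using (⊤; tt)
open import Data.Vec using (Vec; []; _∷_; lookup; tabulate)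
open import Data.Vec.Properties using (lookup∘tabulate)
open import Function using (id; _∘_; _⇔_; mk⇔; case_of_; Equivalence)
open import Function.Definitions using (Injective; StrictlySurjective)
import Function.Properties.Equivalence as ⇔
open import Data.Nat.Solver using (module +-*-Solver)
open +-*-Solver using (solve; _:+_; _:*_; _:^_; _:=_; con)
open import Relation.Binary.PropositionalEquality
  using (_≡_; _≢_; refl; sym; trans; cong; cong₂; subst; module ≡-Reasoning)
open import Relation.Nullary using (¬_; Dec; yes; no; does; contradiction; _×-dec_)
open import Relation.Nullary.Decidable using (does-⇔; T?; ¬?)
open import Relation.Binary using (DecidableEquality; Setoid)
import Relation.Binary.Reasoning.Setoid as SetoidReasoning
open import Relation.Unary using (Pred; Decidable; _⊆_; _∩_; Empty; Satisfiable)

-- Counting decidable subsets of Fin k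

count : ∀ {k} {P : Pred (Fin k) 0ℓ} → Decidable P → ℕ
count {zero}  P? = 0
count {suc k} P? with P? zero
... | yes _ = suc (count (P? ∘ suc))
... | no  _ = count (P? ∘ suc)

count≤ : ∀ {k} {P : Pred (Fin k) 0ℓ} (P? : Decidable P) → count P? ≤ k
count≤ {zero}  P? = z≤n
count≤ {suc k} P? with P? zero
... | yes _ = s≤s (count≤ (P? ∘ suc))
... | no  _ = m≤n⇒m≤1+n (count≤ (P? ∘ suc))

count-mono : ∀ {k} {P Q : Pred (Fin k) 0ℓ} (P? : Decidable P) (Q? : Decidable Q) → P ⊆ Q → count P? ≤ count Q?
count-mono {zero}  P? Q? P⊆Q = z≤n
count-mono {suc k} P? Q? P⊆Q with P? zero | Q? zero | count-mono (P? ∘ suc) (Q? ∘ suc) P⊆Q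
... | yes p | no ¬q | _   = contradiction (P⊆Q p) ¬q
... | yes _ | yes _ | rec = s≤s rec
... | no _  | yes _ | rec = m≤n⇒m≤1+n rec
... | no _  | no _  | rec = rec

count-< : ∀ {k} {P Q : Pred (Fin k) 0ℓ} (P? : Decidable P) (Q? : Decidable Q) → P ⊆ Q → ∀ {i} → Q i → ¬ P i →
          count P? < count Q?
count-< {suc k} P? Q? P⊆Q {zero} Qi ¬Pi with P? zero | Q? zero
... | yes Pi | _     = contradiction Pi ¬Pi
... | no _   | no ¬Qi = contradiction Qi ¬Qi
... | no _   | yes _ = s≤s (count-mono (P? ∘ suc) (Q? ∘ suc) P⊆Q)
count-< {suc k} P? Q? P⊆Q {suc i} Qi ¬Pi
  with P? zero | Q? zero | count-< (P? ∘ suc) (Q? ∘ suc) P⊆Q Qi ¬Pi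
... | yes p | no ¬q | _   = contradiction (P⊆Q p) ¬q
... | yes _ | yes _ | rec = s≤s rec
... | no _  | yes _ | rec = m≤n⇒m≤1+n rec
... | no _  | no _  | rec = rec

count-disjoint : ∀ {k} {P Q R : Pred (Fin k) 0ℓ} (P? : Decidable P) (Q? : Decidable Q) (R? : Decidable R) →
                 Empty (P ∩ Q) → P ⊆ R → Q ⊆ R → count P? + count Q? ≤ count R?
count-disjoint {zero}  P? Q? R? P∩Q=∅ P⊆R Q⊆R = z≤n
count-disjoint {suc k} P? Q? R? P∩Q=∅ P⊆R Q⊆R
  with P? zero | Q? zero | R? zero | count-disjoint (P? ∘ suc) (Q? ∘ suc) (R? ∘ suc) (P∩Q=∅ ∘ suc) P⊆R Q⊆R
... | yes p | yes q | _     | _   = contradiction (p , q) (P∩Q=∅ zero)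
... | yes p | no _  | no ¬r | _   = contradiction (P⊆R p) ¬r
... | no _  | yes q | no ¬r | _   = contradiction (Q⊆R q) ¬r
... | yes _ | no _  | yes _ | rec = s≤s rec
... | no _  | yes _ | yes _ | rec = ≤-trans (ℕ.≤-reflexive (+-suc _ _)) (s≤s rec)
... | no _  | no _  | yes _ | rec = m≤n⇒m≤1+n rec
... | no _  | no _  | no _  | rec = rec

count-satisfiable : ∀ {k} {P : Pred (Fin k) 0ℓ} (P? : Decidable P) → 0 < count P? → Satisfiable P
count-satisfiable {suc k} P? pos with P? zero
... | yes p = zero , p
... | no  _ = let i , p = count-satisfiable (P? ∘ suc) pos in suc i , p

count-pos : ∀ {k} {P : Pred (Fin k) 0ℓ} (P? : Decidable P) → ∀ {i} → P i → 0 < count P?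
count-pos {suc k} P? {i} Pi with P? zero | i
... | yes _ | _     = s≤s z≤n
... | no ¬p | zero  = contradiction Pi ¬p
... | no _  | suc i = count-pos (P? ∘ suc) Pi

count≥2 : ∀ {k} {P : Pred (Fin k) 0ℓ} (P? : Decidable P) → ∀ {i j} → i ≢ j → P i → P j → 2 ≤ count P?
count≥2 P? {i} {j} i≢j Pi Pj =
  ≤-<-trans (count-pos (_≟ i) refl) (count-< (_≟ i) P? (λ { refl → Pi }) Pj (i≢j ∘ sym))

countFin : ∀ {k} {P : Pred (Fin k) 0ℓ} → Decidable P → Fin (suc k)
countFin P? = Fin.fromℕ< (s≤s (count≤ P?))

countFin<countFin⇔ : ∀ {k} {P Q : Pred (Fin k) 0ℓ} (P? : Decidable P) (Q? : Decidable Q) →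
                     countFin P? Fin.< countFin Q? ⇔ count P? < count Q?
countFin<countFin⇔ P? Q?
  rewrite Fin.toℕ-fromℕ< (s≤s (count≤ P?)) | Fin.toℕ-fromℕ< (s≤s (count≤ Q?)) = ⇔.refl

module _ {n : ℕ} (a : Fin n → ℚ) where

  rank : Fin n → ℕ
  rank y = count (λ z → a z ℚ.<? a y)

  rank<count⇔ : {P : Pred ℚ 0ℓ} (P? : Decidable P) → (∀ {p q} → p ℚ.≤ q → P q → P p) →
                ∀ y → rank y < count (P? ∘ a) ⇔ P (a y)
  rank<count⇔ {P} P? P-down y = mk⇔ to from
    where
    to : rank y < count (P? ∘ a) → P (a y)
    to rank< with P? (a y)
    ... | yes Py = Py
    ... | no ¬Py = contradiction (count-mono (P? ∘ a) _ below) (<⇒≱ rank<)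
      where
      below : ∀ {z} → P (a z) → a z ℚ.< a y
      below {z} Pz with a z ℚ.<? a y
      ... | yes z<y = z<y
      ... | no  z≮y = contradiction (P-down (ℚ.≮⇒≥ z≮y) Pz) ¬Py

    from : P (a y) → rank y < count (P? ∘ a)
    from Py = count-< _ (P? ∘ a) (λ z<y → P-down (ℚ.<⇒≤ z<y) Py) Py (ℚ.<-irrefl refl)

-- Walks, paths and branches in trees

module WalkProperties {m : ℕ} {adj : Graph m} (adj-sym : ∀ u v → adj u v ≡ adj v u) where

  flip-edge : ∀ {u v} → adj u v ≡ true → adj v u ≡ true
  flip-edge {u} {v} e = trans (adj-sym v u) e

  firstStep : ∀ {a b} → Walk adj a b → Maybe (Fin m)
  firstStep (here _)             = nothing
  firstStep (step {w = w} _ _) = just w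

  tailVerts : ∀ {a b} → Walk adj a b → List (Fin m)
  tailVerts (here _)   = []
  tailVerts (step _ p) = verts p

  start∈verts : ∀ {a b} (p : Walk adj a b) → a ∈ verts p
  start∈verts (here _)   = here refl
  start∈verts (step _ _) = here refl

  end∈verts : ∀ {a b} (p : Walk adj a b) → b ∈ verts p
  end∈verts (here _)   = here refl
  end∈verts (step _ p) = there (end∈verts p)

  tailVerts⊆verts : ∀ {a b} (p : Walk adj a b) → tailVerts p List.⊆ verts p
  tailVerts⊆verts (here _)   ()
  tailVerts⊆verts (step _ p) = there

  start∉tailVerts : ∀ {a b} {p : Walk adj a b} → IsPath p → a ∉ tailVerts p
  start∉tailVerts {p = here _}   _      ()
  start∉tailVerts {p = step _ _} p-path = Unique[x∷xs]⇒x∉xs p-path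

  firstStep∈tailVerts : ∀ {a b w} (p : Walk adj a b) → firstStep p ≡ just w → w ∈ tailVerts p
  firstStep∈tailVerts (step _ p) refl = start∈verts p

  ∈-verts⁻ : ∀ {a b z} (p : Walk adj a b) → z ∈ verts p → z ≡ a ⊎ z ∈ tailVerts p
  ∈-verts⁻ (here _)   (here z≡a)  = inj₁ z≡a
  ∈-verts⁻ (step _ _) (here z≡a)  = inj₁ z≡a
  ∈-verts⁻ (step _ _) (there z∈p) = inj₂ z∈p

  _++ʷ_ : ∀ {a b c} → Walk adj a b → Walk adj b c → Walk adj a c
  here _   ++ʷ q = q
  step e p ++ʷ q = step e (p ++ʷ q)

  ∈-++ʷ⁻ : ∀ {a b c z} (p : Walk adj a b) (q : Walk adj b c) →
           z ∈ verts (p ++ʷ q) → z ∈ verts p ⊎ z ∈ verts q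
  ∈-++ʷ⁻ (here _)   q z∈         = inj₂ z∈
  ∈-++ʷ⁻ (step e p) q (here z≡)  = inj₁ (here z≡)
  ∈-++ʷ⁻ (step e p) q (there z∈) with ∈-++ʷ⁻ p q z∈
  ... | inj₁ z∈p = inj₁ (there z∈p)
  ... | inj₂ z∈q = inj₂ z∈q

  join : ∀ {c a b} → Walk adj c a → Walk adj c b → Walk adj a b
  join (here _)   q = q
  join (step e p) q = join p (step (flip-edge e) q)

  reverse : ∀ {a b} → Walk adj a b → Walk adj b a
  reverse p = join p (here _)

  ∈-join⁻ : ∀ {c a b z} (p : Walk adj c a) (q : Walk adj c b) →
            z ∈ verts (join p q) → z ∈ tailVerts p ⊎ z ∈ verts q
  ∈-join⁻ (here _)   q z∈ = inj₂ z∈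
  ∈-join⁻ (step e p) q z∈ with ∈-join⁻ p (step (flip-edge e) q) z∈
  ... | inj₁ z∈p         = inj₁ (tailVerts⊆verts p z∈p)
  ... | inj₂ (here refl) = inj₁ (start∈verts p)
  ... | inj₂ (there z∈q) = inj₂ z∈q

  ∈-reverse⁻ : ∀ {a b z} (p : Walk adj a b) → z ∈ verts (reverse p) → z ∈ verts p
  ∈-reverse⁻ p z∈ with ∈-join⁻ p (here _) z∈
  ... | inj₁ z∈p         = tailVerts⊆verts p z∈p
  ... | inj₂ (here refl) = start∈verts p

  join-isPath : ∀ {c a b} (p : Walk adj c a) (q : Walk adj c b) → IsPath p → IsPath q →
                (∀ {z} → z ∈ tailVerts p → z ∉ verts q) → IsPath (join p q)
  join-isPath (here _)   q _              q-path _        = q-path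
  join-isPath (step e p) q (_ ∷ p-path) q-path disjoint =
    join-isPath p (step (flip-edge e) q) p-path
      (¬Any⇒All¬ _ (disjoint (start∈verts p)) ∷ q-path) disjoint′
    where
    disjoint′ : ∀ {z} → z ∈ tailVerts p → z ∉ verts (step (flip-edge e) q)
    disjoint′ z∈p (here refl) = start∉tailVerts p-path z∈p
    disjoint′ z∈p (there z∈q) = disjoint (tailVerts⊆verts p z∈p) z∈q

  walkWeight-join : (w : Fin m → Fin m → ℚ) → (∀ u v → w u v ≡ w v u) →
                    ∀ {c a b} (p : Walk adj c a) (q : Walk adj c b) →
                    walkWeight w (join p q) ≡ walkWeight w p ℚ.+ walkWeight w q
  walkWeight-join w w-sym (here _) q = sym (ℚ.+-identityˡ _)
  walkWeight-join w w-sym (step {u = c} {w = x} e p) q = begin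
    walkWeight w (join p (step (flip-edge e) q)) ≡⟨ walkWeight-join w w-sym p _ ⟩
    ‖ p ‖ ℚ.+ (w x c ℚ.+ ‖ q ‖)                  ≡⟨ cong (λ t → ‖ p ‖ ℚ.+ (t ℚ.+ ‖ q ‖)) (w-sym x c) ⟩
    ‖ p ‖ ℚ.+ (w c x ℚ.+ ‖ q ‖)                  ≡⟨ ℚ.+-assoc (‖ p ‖) (w c x) (‖ q ‖) ⟨
    (‖ p ‖ ℚ.+ w c x) ℚ.+ ‖ q ‖                  ≡⟨ cong (ℚ._+ ‖ q ‖) (ℚ.+-comm (‖ p ‖) (w c x)) ⟩
    (w c x ℚ.+ ‖ p ‖) ℚ.+ ‖ q ‖                  ∎
    where
    open ≡-Reasoning
    ‖_‖ : ∀ {a b} → Walk adj a b → ℚ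
    ‖_‖ = walkWeight w

  suffixFrom : ∀ {a b z} (p : Walk adj a b) → z ∈ verts p →
               Σ (Walk adj z b) λ r → (IsPath p → IsPath r) × verts r List.⊆ verts p
  suffixFrom p@(here _)   (here refl) = p , id , id
  suffixFrom p@(step _ _) (here refl) = p , id , id
  suffixFrom (step e p)   (there z∈p) =
    let r , r-path , r⊆p = suffixFrom p z∈p
    in r , (λ { (_ ∷ p-path) → r-path p-path }) , there ∘ r⊆p

  prefixTo : ∀ {a b z} (p : Walk adj a b) → z ∈ verts p →
             Σ (Walk adj a z) λ r → (IsPath p → IsPath r) × verts r List.⊆ verts p
  prefixTo p@(here _) (here refl) = p , id , id
  prefixTo (step e p) (here refl) = here _ , (λ _ → [] ∷ []) , λ { (here refl) → here refl }
  prefixTo (step e p) (there z∈p) =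
    let r , r-path , r⊆p = prefixTo p z∈p
    in step e r , (λ { (a∉p ∷ p-path) → anti-mono r⊆p a∉p ∷ r-path p-path }) ,
       λ { (here refl) → here refl ; (there z∈r) → there (r⊆p z∈r) }

  firstStep-prefixTo : ∀ {a b z} (p : Walk adj a b) (z∈p : z ∈ tailVerts p) →
                       firstStep (proj₁ (prefixTo p (tailVerts⊆verts p z∈p))) ≡ firstStep p
  firstStep-prefixTo (step e p) z∈p = refl

  toPath : ∀ {a b} (w : Walk adj a b) → Σ (Walk adj a b) λ p → IsPath p × verts p List.⊆ verts w
  toPath (here a) = here a , [] ∷ [] , id
  toPath (step {u = a} e w) with toPath w
  ... | p , p-path , p⊆w with any? (a ≟_) (verts p)
  ...   | yes a∈p = let r , r-path , r⊆p = suffixFrom p a∈p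
                    in r , r-path p-path , there ∘ p⊆w ∘ r⊆p
  ...   | no  a∉p = step e p , ¬Any⇒All¬ _ a∉p ∷ p-path ,
                    λ { (here refl) → here refl ; (there z∈p) → there (p⊆w z∈p) }

  verts-length≥2 : ∀ {u v} → u ≢ v → (p : Walk adj u v) → 2 ≤ length (verts p)
  verts-length≥2 u≢v (here _)            = contradiction refl u≢v
  verts-length≥2 _   (step _ (here _))   = s≤s (s≤s z≤n)
  verts-length≥2 _   (step _ (step _ _)) = s≤s (s≤s z≤n)

module ForestProperties {m : ℕ} {adj : Graph m} (adj-sym : ∀ u v → adj u v ≡ adj v u)
                        (acyclic : ¬ HasCycle adj) where

  open WalkProperties adj-sym public

  firstStep-unique : ∀ {a b} (p q : Walk adj a b) → IsPath p → IsPath q → firstStep p ≡ firstStep q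
  firstStep-unique (here _)   (here _)   _ _ = refl
  firstStep-unique (here _)   (step _ q) _ q-path = contradiction (end∈verts q) (Unique[x∷xs]⇒x∉xs q-path)
  firstStep-unique (step _ p) (here _)   p-path _ = contradiction (end∈verts p) (Unique[x∷xs]⇒x∉xs p-path)
  firstStep-unique {a} (step {w = u} e p) (step {w = v} e′ q) p-path q-path with u ≟ v
  ... | yes refl = refl
  -- otherwise tail p and reverse (tail q) join u to v avoiding a, closing a cycle through a
  ... | no u≢v   with toPath (p ++ʷ reverse q)
  ...   | r , r-path , r⊆ =
    contradiction (a , v , step e r , ¬Any⇒All¬ _ a∉r ∷ r-path , s≤s (verts-length≥2 u≢v r) , flip-edge e′)
                  acyclic
    where
    a∉r : a ∉ verts r
    a∉r a∈r with ∈-++ʷ⁻ p (reverse q) (r⊆ a∈r)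
    ... | inj₁ a∈p = Unique[x∷xs]⇒x∉xs p-path a∈p
    ... | inj₂ a∈q = Unique[x∷xs]⇒x∉xs q-path (∈-reverse⁻ q a∈q)

module Branches {m : ℕ} (T : WTree m) where

  open WTree T
  open ForestProperties (proj₁ simple) acyclic public

  path : ∀ u v → Walk adj u v
  path u v = proj₁ (toPath (connected u v))

  path-isPath : ∀ u v → IsPath (path u v)
  path-isPath u v = proj₁ (proj₂ (toPath (connected u v)))

  dist : Fin m → Fin m → ℚ
  dist u v = walkWeight weight (path u v)

  branch : Fin m → Fin m → Maybe (Fin m)
  branch c v = firstStep (path c v)

  branch-unique : ∀ {c v} (p : Walk adj c v) → IsPath p → branch c v ≡ firstStep p
  branch-unique p p-path = firstStep-unique _ p (path-isPath _ _) p-path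

  branch-self : ∀ c → branch c c ≡ nothing
  branch-self c = branch-unique (here c) ([] ∷ [])

  branch≡nothing⇒≡ : ∀ {c v} → branch c v ≡ nothing → v ≡ c
  branch≡nothing⇒≡ {c} {v} = helper (path c v)
    where
    helper : (p : Walk adj c v) → firstStep p ≡ nothing → v ≡ c
    helper (here _) _ = refl

  branch-adj : ∀ {c v u} → branch c v ≡ just u → adj c u ≡ true
  branch-adj {c} {v} = helper (path c v)
    where
    helper : ∀ {u} (p : Walk adj c v) → firstStep p ≡ just u → adj c u ≡ true
    helper (step e _) refl = e

  adj⇒≢ : ∀ {u v} → adj u v ≡ true → u ≢ v
  adj⇒≢ {u} e refl with trans (sym e) (proj₂ simple u)
  ... | ()

  branch-neighbour : ∀ {c u} → adj c u ≡ true → branch c u ≡ just u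
  branch-neighbour e =
    branch-unique (step e (here _)) (¬Any⇒All¬ _ (λ { (here c≡u) → adj⇒≢ e c≡u }) ∷ [] ∷ [])

  branch-on-path : ∀ {c b z} (p : Walk adj c b) → IsPath p → z ∈ tailVerts p → branch c z ≡ firstStep p
  branch-on-path p p-path z∈p =
    let r , r-path , _ = prefixTo p (tailVerts⊆verts p z∈p)
    in trans (branch-unique r (r-path p-path)) (firstStep-prefixTo p z∈p)

  branch-away : ∀ {c u w z} → adj c u ≡ true → w ≢ c → branch u z ≡ just w → branch c z ≡ just u
  branch-away {c} {u} {w} {z} e w≢c u→w = branch-unique (step e (path u z)) (¬Any⇒All¬ _ c∉p ∷ path-isPath u z)
    where
    c∉p : c ∉ verts (path u z)
    c∉p c∈p with ∈-verts⁻ (path u z) c∈p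
    ... | inj₁ c≡u = adj⇒≢ e c≡u
    ... | inj₂ c∈p′ = w≢c (just-injective (begin
      just w      ≡⟨ u→w ⟨
      branch u z  ≡⟨ branch-on-path (path u z) (path-isPath u z) c∈p′ ⟨
      branch u c  ≡⟨ branch-neighbour (flip-edge e) ⟩
      just c      ∎))
      where open ≡-Reasoning

  branch-back : ∀ {c u z} → branch c z ≡ just u → branch u z ≢ just c
  branch-back {c} {u} {z} = helper (path c z) (path-isPath c z)
    where
    helper : (p : Walk adj c z) → IsPath p → firstStep p ≡ just u → branch u z ≢ just c
    helper (step e p) p-path@(_ ∷ p′-path) refl u→c =
      Unique[x∷xs]⇒x∉xs p-path
        (tailVerts⊆verts p (firstStep∈tailVerts p (trans (sym (branch-unique p p′-path)) u→c)))

  pathThrough : ∀ {c a b} → branch c a ≢ branch c b →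
                Σ (Walk adj a b) λ p → IsPath p × walkWeight weight p ≡ dist c a ℚ.+ dist c b
  pathThrough {c} {a} {b} a≁b =
    join (path c a) (path c b) ,
    join-isPath _ _ (path-isPath c a) (path-isPath c b) disjoint ,
    walkWeight-join weight weightSym (path c a) (path c b)
    where
    disjoint : ∀ {z} → z ∈ tailVerts (path c a) → z ∉ verts (path c b)
    disjoint z∈a z∈b with ∈-verts⁻ (path c b) z∈b
    ... | inj₁ refl = start∉tailVerts (path-isPath c a) z∈a
    ... | inj₂ z∈b′ = a≁b (trans (sym (branch-on-path _ (path-isPath c a) z∈a))
                                 (branch-on-path _ (path-isPath c b) z∈b′))

_≟ᴹ_ : ∀ {m} → DecidableEquality (Maybe (Fin m))
_≟ᴹ_ = ≡-decᴹ _≟_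

module Centroid {m n : ℕ} (T : WTree m) (ζ : Fin n → Fin m) {S : Pred (Fin n) 0ℓ} (S? : Decidable S) where

  open WTree T using (adj)
  open Branches T

  InBranch : Fin m → Fin m → Pred (Fin n) 0ℓ
  InBranch c u x = S x × branch c (ζ x) ≡ just u

  inBranch? : ∀ c u → Decidable (InBranch c u)
  inBranch? c u x = S? x ×-dec (branch c (ζ x) ≟ᴹ just u)

  mass : Fin m → Fin m → ℕ
  mass c u = count (inBranch? c u)

  Balanced : Fin m → Set
  Balanced c = ∀ u → 2 * mass c u ≤ count S?

  private
    Heavy : Fin m → Fin m → Set
    Heavy c u = count S? < 2 * mass c u

    balanced-or-heavy : ∀ c → Balanced c ⊎ ∃ (Heavy c)
    balanced-or-heavy c with Fin.any? (λ u → count S? ℕ.<? 2 * mass c u)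
    ... | yes heavy = inj₂ heavy
    ... | no ¬heavy = inj₁ λ u → ≮⇒≥ (¬heavy ∘ (u ,_))

    heavy⇒adj : ∀ {c u} → Heavy c u → adj c u ≡ true
    heavy⇒adj {c} {u} heavy =
      let _ , _ , c→u = count-satisfiable (inBranch? c u) (ℕ.*-cancelˡ-< 2 0 (mass c u) (≤-<-trans z≤n heavy))
      in branch-adj c→u

    heavy-asym : ∀ {c u} → Heavy c u → ¬ Heavy u c
    heavy-asym {c} {u} c→u u→c = ℕ.<-irrefl refl (begin-strict
      2 * count S?                ≡⟨ solve 1 (λ s → con 2 :* s := s :+ s) refl (count S?) ⟩
      count S? + count S?         <⟨ +-mono-< c→u u→c ⟩
      2 * mass c u + 2 * mass u c ≡⟨ ℕ.*-distribˡ-+ 2 (mass c u) (mass u c) ⟨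
      2 * (mass c u + mass u c)   ≤⟨ *-monoʳ-≤ 2 (count-disjoint (inBranch? c u) (inBranch? u c) S?
                                                                 disjoint proj₁ proj₁) ⟩
      2 * count S?                ∎)
      where
      open ℕ.≤-Reasoning
      disjoint : Empty (InBranch c u ∩ InBranch u c)
      disjoint x ((_ , c→x) , (_ , u→x)) = branch-back c→x u→x

    size : Fin m → Fin m → ℕ
    size c u = count (λ v → branch c v ≟ᴹ just u)

    size-decreasing : ∀ {c u w} → adj c u ≡ true → w ≢ c → size u w < size c u
    size-decreasing {c} {u} {w} e w≢c =
      count-< (λ v → branch u v ≟ᴹ just w) (λ v → branch c v ≟ᴹ just u) (branch-away e w≢c)
              {u} (branch-neighbour e) (λ u→w → case trans (sym u→w) (branch-self u) of λ ())

    descend : ∀ fuel c u → Heavy c u → size c u < fuel → ∃ Balanced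
    descend (suc fuel) c u c→u (s≤s size<fuel) with balanced-or-heavy u
    ... | inj₁ balanced    = u , balanced
    ... | inj₂ (w , u→w) = descend fuel u w u→w (<-≤-trans (size-decreasing (heavy⇒adj c→u) w≢c) size<fuel)
      where
      w≢c : w ≢ c
      w≢c refl = heavy-asym c→u u→w

  centroid : Fin m → ∃ Balanced
  centroid v with balanced-or-heavy v
  ... | inj₁ balanced    = v , balanced
  ... | inj₂ (u , v→u) = descend (suc m) v u v→u (s≤s (count≤ _))

-- Encoding PCGs and threshold PCGs by labels

record Label (n : ℕ) : Set where
  constructor label
  field
    rep               : Fin n
    position low high : Fin (suc n)

Separated : ∀ {n} → Label n → Label n → Set
Separated ℓ ℓ′ = ¬ (Label.position ℓ′ Fin.< Label.low ℓ) × Label.position ℓ′ Fin.< Label.high ℓ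

separated? : ∀ {n} (ℓ ℓ′ : Label n) → Dec (Separated ℓ ℓ′)
separated? ℓ ℓ′ = ¬? (Label.position ℓ′ Fin.<? Label.low ℓ) ×-dec (Label.position ℓ′ Fin.<? Label.high ℓ)

adjacentByLabels : ∀ {n L} → Vec (Label n) L → Vec (Label n) L → Bool
adjacentByLabels []       []         = false
adjacentByLabels (ℓ ∷ ls) (ℓ′ ∷ ls′) with Label.rep ℓ ≟ Label.rep ℓ′
... | yes _ = adjacentByLabels ls ls′
... | no  _ = does (separated? ℓ ℓ′)

decodePCG : ∀ {n L} → Vec (Vec (Label n) L) n → Graph n
decodePCG ls x y = adjacentByLabels (lookup ls x) (lookup ls y)

-- default is a junk value: the representative of a branch without vertices of S, and the vertex
-- where the centroid search starts.
module Labelling {n m : ℕ} (T : WTree m) (ζ : Fin n → Fin m) (dmin dmax : ℚ) (default : Fin n) where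

  open WTree T using (adj; weight)
  open Branches T

  module _ {S : Pred (Fin n) 0ℓ} (S? : Decidable S) where

    -- Opaque, so that the type checker never unfolds the centroid search.
    opaque
      centre : Fin m
      centre = proj₁ (Centroid.centroid T ζ S? (ζ default))

      centre-balanced : Centroid.Balanced T ζ S? centre
      centre-balanced = proj₂ (Centroid.centroid T ζ S? (ζ default))

    height : Fin n → ℚ
    height x = dist centre (ζ x)

    branchOf : Fin n → Maybe (Fin m)
    branchOf x = branch centre (ζ x)

    representative : Maybe (Fin m) → Fin n
    representative b with Fin.any? (λ z → S? z ×-dec (branchOf z ≟ᴹ b))
    ... | yes (z , _) = z
    ... | no  _       = default

    rep : Fin n → Fin n
    rep x = representative (branchOf x)

    rep-correct : ∀ {x} → S x → S (rep x) × branchOf (rep x) ≡ branchOf x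
    rep-correct {x} Sx with Fin.any? (λ z → S? z ×-dec (branchOf z ≟ᴹ branchOf x))
    ... | yes (_ , correct) = correct
    ... | no  none          = contradiction (x , Sx , refl) none

    rep≡⇒branchOf≡ : ∀ {x y} → S x → S y → rep x ≡ rep y → branchOf x ≡ branchOf y
    rep≡⇒branchOf≡ {x} {y} Sx Sy rx≡ry = begin
      branchOf x        ≡⟨ proj₂ (rep-correct Sx) ⟨
      branchOf (rep x)  ≡⟨ cong branchOf rx≡ry ⟩
      branchOf (rep y)  ≡⟨ proj₂ (rep-correct Sy) ⟩
      branchOf y        ∎
      where open ≡-Reasoning

    levelLabel : Fin n → Label n
    levelLabel x = label (rep x)
                         (countFin (λ z → height z ℚ.<? height x))
                         (countFin (λ z → (height x ℚ.+ height z) ℚ.<? dmin))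
                         (countFin (λ z → (height x ℚ.+ height z) ℚ.≤? dmax))

    next : (φ : Fin n) → Decidable (λ z → S z × rep z ≡ φ)
    next φ z = S? z ×-dec (rep z ≟ φ)

  labels : ∀ L {S : Pred (Fin n) 0ℓ} → Decidable S → Fin n → Vec (Label n) L
  labels zero    S? x = []
  labels (suc L) S? x = levelLabel S? x ∷ labels L (next S? (rep S? x)) x

  module _ (ζ-injective : Injective _≡_ _≡_ ζ) {S : Pred (Fin n) 0ℓ} (S? : Decidable S) where

    next-halves : ∀ {x y} → S x → S y → x ≢ y → rep S? x ≡ rep S? y →
                  2 * count (next S? (rep S? x)) ≤ count S?
    next-halves {x} {y} Sx Sy x≢y rx≡ry = helper (branchOf S? x) refl
      where
      helper : ∀ b → branchOf S? x ≡ b → 2 * count (next S? (rep S? x)) ≤ count S?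
      helper nothing x→b =
        contradiction (ζ-injective (trans (branch≡nothing⇒≡ x→b) (sym (branch≡nothing⇒≡ y→b)))) x≢y
        where
        y→b : branchOf S? y ≡ nothing
        y→b = trans (sym (rep≡⇒branchOf≡ S? Sx Sy rx≡ry)) x→b
      helper (just u) x→b =
        ≤-trans (*-monoʳ-≤ 2 (count-mono (next S? (rep S? x)) (Centroid.inBranch? T ζ S? _ u) inBranch))
                (centre-balanced S? u)
        where
        inBranch : ∀ {z} → S z × rep S? z ≡ rep S? x → S z × branchOf S? z ≡ just u
        inBranch (Sz , rz≡rx) = Sz , trans (rep≡⇒branchOf≡ S? Sz Sx rz≡rx) x→b

  module _ {G : Graph n} (ζ-injective : Injective _≡_ _≡_ ζ)
           (compatible : ∀ x y → x ≢ y → (p : Walk adj (ζ x) (ζ y)) → IsPath p →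
                         (G x y ≡ true) ⇔ (dmin ℚ.≤ walkWeight weight p × walkWeight weight p ℚ.≤ dmax))
           where

    separated-correct : ∀ {S : Pred (Fin n) 0ℓ} (S? : Decidable S) {x y} → x ≢ y → rep S? x ≢ rep S? y →
                        does (separated? (levelLabel S? x) (levelLabel S? y)) ≡ G x y
    separated-correct S? {x} {y} x≢y rx≢ry =
      does-⇔ (⇔.trans separated⇔ (⇔.sym edge⇔)) (separated? (levelLabel S? x) (levelLabel S? y)) (T? (G x y))
      where
      a : Fin n → ℚ
      a = height S?

      s : ℚ
      s = a x ℚ.+ a y

      edge⇔ : Bool.T (G x y) ⇔ (dmin ℚ.≤ s × s ℚ.≤ dmax)
      edge⇔ with pathThrough (rx≢ry ∘ cong (representative S?))
      ... | p , p-path , ‖p‖≡s =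
        ⇔.trans T-≡ (subst (λ w → (G x y ≡ true) ⇔ (dmin ℚ.≤ w × w ℚ.≤ dmax)) ‖p‖≡s
                           (compatible x y x≢y p p-path))

      below⇔ : Label.position (levelLabel S? y) Fin.< Label.low (levelLabel S? x) ⇔ s ℚ.< dmin
      below⇔ = ⇔.trans (countFin<countFin⇔ _ _)
                       (rank<count⇔ a (λ q → (a x ℚ.+ q) ℚ.<? dmin) (ℚ.≤-<-trans ∘ ℚ.+-monoʳ-≤ (a x)) y)

      within⇔ : Label.position (levelLabel S? y) Fin.< Label.high (levelLabel S? x) ⇔ s ℚ.≤ dmax
      within⇔ = ⇔.trans (countFin<countFin⇔ _ _)
                        (rank<count⇔ a (λ q → (a x ℚ.+ q) ℚ.≤? dmax) (ℚ.≤-trans ∘ ℚ.+-monoʳ-≤ (a x)) y)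

      separated⇔ : Separated (levelLabel S? x) (levelLabel S? y) ⇔ (dmin ℚ.≤ s × s ℚ.≤ dmax)
      separated⇔ = mk⇔
        (λ (¬below , within) → ℚ.≮⇒≥ (¬below ∘ Equivalence.from below⇔) , Equivalence.to within⇔ within)
        (λ (dmin≤s , s≤dmax) →
           (λ below → ℚ.<-irrefl refl (ℚ.≤-<-trans dmin≤s (Equivalence.to below⇔ below))) ,
           Equivalence.from within⇔ s≤dmax)

    labels-correct : ∀ L {S : Pred (Fin n) 0ℓ} (S? : Decidable S) {x y} → S x → S y → x ≢ y →
                     count S? < 2 * 2 ^ L → adjacentByLabels (labels L S? x) (labels L S? y) ≡ G x y
    labels-correct zero    S? Sx Sy x≢y small = contradiction (count≥2 S? x≢y Sx Sy) (<⇒≱ small)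
    labels-correct (suc L) S? {x} {y} Sx Sy x≢y small with rep S? x ≟ rep S? y
    ... | no  rx≢ry = separated-correct S? x≢y rx≢ry
    ... | yes rx≡ry =
      subst (λ φ → adjacentByLabels (labels L (next S? (rep S? x)) x) (labels L (next S? φ) y) ≡ G x y) rx≡ry
            (labels-correct L (next S? (rep S? x)) (Sx , refl) (Sy , sym rx≡ry) x≢y smaller)
      where
      smaller : count (next S? (rep S? x)) < 2 * 2 ^ L
      smaller = ℕ.*-cancelˡ-< 2 _ _ (≤-<-trans (next-halves ζ-injective S? Sx Sy x≢y rx≡ry) small)

pcg-labelled : ∀ {n} L (G : Graph n) → IsPCG G → n < 2 * 2 ^ L →
               Σ (Vec (Vec (Label n) L) n) λ ls → SameGraph G (decodePCG ls)
pcg-labelled {zero}  L G _ _ = [] , λ ()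
pcg-labelled {suc n} L G (_ , T , dmin , dmax , ζ , _ , _ , ζ-injective , _ , _ , compatible) n<2^L =
  tabulate (labels L everyone) , same
  where
  open Labelling T ζ dmin dmax zero

  everyone : Decidable {A = Fin (suc n)} (λ _ → ⊤)
  everyone _ = yes tt

  same : SameGraph G (decodePCG (tabulate (labels L everyone)))
  same x y x≢y = sym (begin
    decodePCG (tabulate (labels L everyone)) x y
      ≡⟨ cong₂ adjacentByLabels (lookup∘tabulate (labels L everyone) x)
                                (lookup∘tabulate (labels L everyone) y) ⟩
    adjacentByLabels (labels L everyone x) (labels L everyone y)
      ≡⟨ labels-correct ζ-injective compatible L everyone tt tt x≢y (≤-<-trans (count≤ everyone) n<2^L) ⟩
    G x y ∎)
    where open ≡-Reasoning

-- Counting codes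

Enumeration : Set → ℕ → Set
Enumeration A M = Σ (Fin M → A) (StrictlySurjective _≡_)

enum-Fin : ∀ k → Enumeration (Fin k) k
enum-Fin k = id , λ i → i , refl

enum-map : ∀ {A B : Set} {M} (f : A → B) → StrictlySurjective _≡_ f → Enumeration A M → Enumeration B M
enum-map f f-onto (g , g-onto) = f ∘ g , onto
  where
  onto : StrictlySurjective _≡_ (f ∘ g)
  onto b = let a , fa≡b = f-onto b ; i , gi≡a = g-onto a in i , trans (cong f gi≡a) fa≡b

enum-× : ∀ {A B : Set} {a b} → Enumeration A a → Enumeration B b → Enumeration (A × B) (a * b)
enum-× {A} {B} {a} {b} (f , f-onto) (g , g-onto) = decode , onto
  where
  decode : Fin (a * b) → A × B
  decode k = let i , j = Fin.remQuot b k in f i , g j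
  onto : StrictlySurjective _≡_ decode
  onto (x , y) =
    let i , fi≡x = f-onto x ; j , gj≡y = g-onto y
    in Fin.combine i j , trans (cong (λ (i , j) → f i , g j) (Fin.remQuot-combine i j)) (cong₂ _,_ fi≡x gj≡y)

enum-Vec : ∀ {A : Set} {a} → Enumeration A a → ∀ L → Enumeration (Vec A L) (a ^ L)
enum-Vec E zero    = (λ _ → []) , λ { [] → zero , refl }
enum-Vec E (suc L) = enum-map (uncurry _∷_) (λ { (x ∷ xs) → (x , xs) , refl }) (enum-× E (enum-Vec E L))

labelCount : ℕ → ℕ
labelCount n = n * (suc n * (suc n * suc n))

enum-Label : ∀ n → Enumeration (Label n) (labelCount n)
enum-Label n =
  enum-map (λ (r , p , l , h) → label r p l h) (λ (label r p l h) → (r , p , l , h) , refl)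
           (enum-× (enum-Fin n) (enum-× (enum-Fin (suc n)) (enum-× (enum-Fin (suc n)) (enum-Fin (suc n)))))

ThresholdCode : ℕ → ℕ → ℕ → Set
ThresholdCode n k L = Fin (suc k) × Vec (Vec (Vec (Label n) L) n) k

decodeThreshold : ∀ {n k L} → ThresholdCode n k L → Graph n
decodeThreshold {k = k} (t , lss) u v = does (toℕ t ℕ.≤? countEdge k (λ i → decodePCG (lookup lss i)) u v)

countEdge-cong : ∀ {n} k (Gs Hs : Fin k → Graph n) {u v} → (∀ i → Gs i u v ≡ Hs i u v) →
                 countEdge k Gs u v ≡ countEdge k Hs u v
countEdge-cong zero    Gs Hs same = refl
countEdge-cong (suc k) Gs Hs same =
  cong₂ _+_ (cong (λ b → if b then 1 else 0) (same zero)) (countEdge-cong k (Gs ∘ suc) (Hs ∘ suc) (same ∘ suc))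

thresholdPCG-coded : ∀ {n} k L (G : Graph n) → InT n k G → n < 2 * 2 ^ L →
                  Σ (ThresholdCode n k L) λ c → SameGraph G (decodeThreshold c)
thresholdPCG-coded k L G (_ , t , _ , t≤k , Gs , pcgs , threshold) n<2^L =
  (Fin.fromℕ< (s≤s t≤k) , tabulate codes) , same
  where
  codes : Fin k → Vec (Vec (Label _) L) _
  codes i = proj₁ (pcg-labelled L (Gs i) (proj₂ (pcgs i)) n<2^L)

  same : SameGraph G (decodeThreshold (Fin.fromℕ< (s≤s t≤k) , tabulate codes))
  same u v u≢v = begin
    G u v
      ≡⟨ does-⇔ (⇔.trans T-≡ (threshold u v u≢v)) (T? (G u v)) (t ℕ.≤? countEdge k Gs u v) ⟩
    does (t ℕ.≤? countEdge k Gs u v)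
      ≡⟨ cong₂ (λ t′ c → does (t′ ℕ.≤? c)) (sym (Fin.toℕ-fromℕ< (s≤s t≤k)))
               (countEdge-cong k _ _ decoded) ⟩
    decodeThreshold (Fin.fromℕ< (s≤s t≤k) , tabulate codes) u v ∎
    where
    open ≡-Reasoning
    decoded : ∀ i → Gs i u v ≡ decodePCG (lookup (tabulate codes) i) u v
    decoded i = trans (proj₂ (pcg-labelled L (Gs i) (proj₂ (pcgs i)) n<2^L) u v u≢v)
                      (cong (λ ls → decodePCG ls u v) (sym (lookup∘tabulate codes i)))

SameGraph-setoid : ℕ → Setoid 0ℓ 0ℓ
SameGraph-setoid n = record
  { Carrier       = Graph n
  ; _≈_           = SameGraph
  ; isEquivalence = record
    { refl  = λ _ _ _ → refl
    ; sym   = λ G≈H u v u≢v → sym (G≈H u v u≢v)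
    ; trans = λ G≈H H≈K u v u≢v → trans (G≈H u v u≢v) (H≈K u v u≢v)
    }
  }

lookup-AllPairs : ∀ {a r} {A : Set a} {R : A → A → Set r} {xs : List A} → AllPairs R xs →
                  ∀ {i j} → i Fin.< j → R (List.lookup xs i) (List.lookup xs j)
lookup-AllPairs (x∼xs ∷ _)    {zero}  {suc j} _         = All.lookup x∼xs (∈-lookup j)
lookup-AllPairs (_ ∷ distinct) {suc i} {suc j} (s≤s i<j) = lookup-AllPairs distinct i<j

module _ {a ℓ} (S : Setoid a ℓ) where

  open Setoid S using (Carrier; _≈_)

  enumerated-distinct-length≤ : ∀ {A : Set} {M} → Enumeration A M → (decode : A → Carrier) → ∀ {xs} →
                                All (λ x → ∃ λ c → x ≈ decode c) xs → AllPairs (λ x y → ¬ x ≈ y) xs →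
                                length xs ≤ M
  enumerated-distinct-length≤ {M = M} (e , e-onto) decode {xs} coded distinct = ≮⇒≥ λ M<length →
    let i , j , i<j , same = Fin.pigeonhole M<length index in lookup-AllPairs distinct i<j (collide same)
    where
    code : ∀ i → ∃ λ c → List.lookup xs i ≈ decode c
    code i = All.lookup coded (∈-lookup i)

    index : Fin (length xs) → Fin M
    index i = proj₁ (e-onto (proj₁ (code i)))

    decode-index : ∀ i → decode (e (index i)) ≡ decode (proj₁ (code i))
    decode-index i = cong decode (proj₂ (e-onto (proj₁ (code i))))

    collide : ∀ {i j} → index i ≡ index j → List.lookup xs i ≈ List.lookup xs j
    collide {i} {j} same = begin
      List.lookup xs i          ≈⟨ proj₂ (code i) ⟩
      decode (proj₁ (code i))   ≡⟨ trans (sym (decode-index i)) (trans (cong (decode ∘ e) same) (decode-index j)) ⟩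
      decode (proj₁ (code j))   ≈⟨ proj₂ (code j) ⟨
      List.lookup xs j          ∎
      where open SetoidReasoning S

enum-ThresholdCode : ∀ n k L → Enumeration (ThresholdCode n k L) (suc k * (((labelCount n ^ L) ^ n) ^ k))
enum-ThresholdCode n k L = enum-× (enum-Fin (suc k)) (enum-Vec (enum-Vec (enum-Vec (enum-Label n) L) n) k)

few-thresholdPCGs : ∀ {n} k L (Gs : List (Graph n)) → n < 2 * 2 ^ L → DistinctMembers n k Gs →
                    length Gs ≤ suc k * (((labelCount n ^ L) ^ n) ^ k)
few-thresholdPCGs k L Gs n<2·2^L (members , distinct) =
  enumerated-distinct-length≤ (SameGraph-setoid _) (enum-ThresholdCode _ k L) decodeThreshold
    (All.map (λ {G} G∈T → thresholdPCG-coded k L G G∈T n<2·2^L) members) distinct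

-- Arithmetic

2*nC2+n≡n*n : ∀ n → 2 * (n C 2) + n ≡ n * n
2*nC2+n≡n*n zero    = refl
2*nC2+n≡n*n (suc n) = begin
  2 * (suc n C 2) + suc n
    ≡⟨ cong (λ t → 2 * t + suc n) (nCk+nC[k+1]≡[n+1]C[k+1] n 1) ⟨
  2 * (n C 1 + n C 2) + suc n
    ≡⟨ cong (λ t → 2 * (t + n C 2) + suc n) (nC1≡n n) ⟩
  2 * (n + n C 2) + suc n
    ≡⟨ solve 2 (λ n c → con 2 :* (n :+ c) :+ (con 1 :+ n) := (con 2 :* c :+ n) :+ (con 1 :+ con 2 :* n))
               refl n (n C 2) ⟩
  (2 * (n C 2) + n) + (1 + 2 * n)
    ≡⟨ cong (_+ (1 + 2 * n)) (2*nC2+n≡n*n n) ⟩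
  n * n + (1 + 2 * n)
    ≡⟨ solve 1 (λ n → n :* n :+ (con 1 :+ con 2 :* n) := (con 1 :+ n) :* (con 1 :+ n)) refl n ⟩
  suc n * suc n ∎
  where open ≡-Reasoning

n<2^n : ∀ n → n < 2 ^ n
n<2^n zero    = s≤s z≤n
n<2^n (suc n) = +-mono-≤ (ℕ.m^n>0 2 n) (≤-trans (n<2^n n) (ℕ.m≤m+n (2 ^ n) 0))

log₂-bracket : ∀ n → ∃ λ L → suc n < 2 ^ L × 2 ^ L ≤ 2 * suc n
log₂-bracket zero = 1 , ≤-refl , ≤-refl
log₂-bracket (suc n) with log₂-bracket n
... | L , n<2^L , 2^L≤2n with suc (suc n) ℕ.<? 2 ^ L
...   | yes below = L , below , ≤-trans 2^L≤2n (*-monoʳ-≤ 2 (ℕ.n≤1+n (suc n)))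
...   | no  ¬below =
  suc L , subst (suc (suc n) <_) (cong (2 *_) 2^L≡) (ℕ.m<m+n (suc (suc n)) (s≤s z≤n)) ,
  ℕ.≤-reflexive (cong (2 *_) (sym 2^L≡))
  where
  2^L≡ : suc (suc n) ≡ 2 ^ L
  2^L≡ = ℕ.≤-antisym n<2^L (≮⇒≥ ¬below)

square-step : ∀ L → 3 ≤ L → suc L * suc L ≤ 2 * (L * L)
square-step L 3≤L = begin
  suc L * suc L      ≡⟨ solve 1 (λ L → (con 1 :+ L) :* (con 1 :+ L) := L :* L :+ (con 1 :+ con 2 :* L)) refl L ⟩
  L * L + (1 + 2 * L) ≤⟨ +-mono-≤ (≤-refl {L * L}) (+-mono-≤ (≤-trans (s≤s z≤n) 3≤L) ≤-refl) ⟩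
  L * L + (L + 2 * L) ≡⟨ solve 1 (λ L → L :* L :+ (L :+ con 2 :* L) := L :* L :+ con 3 :* L) refl L ⟩
  L * L + 3 * L       ≤⟨ +-mono-≤ (≤-refl {L * L}) (ℕ.*-monoˡ-≤ L 3≤L) ⟩
  L * L + L * L       ≡⟨ solve 1 (λ L → L :* L :+ L :* L := con 2 :* (L :* L)) refl L ⟩
  2 * (L * L)         ∎
  where open ℕ.≤-Reasoning

square≤2^ : ∀ j → (4 + j) * (4 + j) ≤ 2 ^ (4 + j)
square≤2^ zero    = ≤-refl
square≤2^ (suc j) = ≤-trans (square-step (4 + j) (s≤s (s≤s (s≤s z≤n)))) (*-monoʳ-≤ 2 (square≤2^ j))

eventually-c*L²≤2^L : ∀ c → ∃ λ L₀ → ∀ {L} → L₀ ≤ L → c * (L * L) ≤ 2 ^ L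
eventually-c*L²≤2^L c = a + a , go _
  where
  a = 4 + c
  open ℕ.≤-Reasoning

  base : c * ((a + a) * (a + a)) ≤ 2 ^ (a + a)
  base = begin
    c * ((a + a) * (a + a)) ≡⟨ solve 2 (λ c a → c :* ((a :+ a) :* (a :+ a)) := (con 4 :* c) :* (a :* a)) refl c a ⟩
    (4 * c) * (a * a)       ≤⟨ *-mono-≤ 4c≤2^a (square≤2^ c) ⟩
    2 ^ a * 2 ^ a           ≡⟨ ℕ.^-distribˡ-+-* 2 a a ⟨
    2 ^ (a + a)             ∎
    where
    4c≤2^a : 4 * c ≤ 2 ^ a
    4c≤2^a = ≤-trans (*-monoʳ-≤ 4 (ℕ.m≤n+m c 4)) (≤-trans (ℕ.*-monoˡ-≤ a (ℕ.m≤m+n 4 c)) (square≤2^ c))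

  grow : ∀ L → 3 ≤ L → c * (L * L) ≤ 2 ^ L → c * (suc L * suc L) ≤ 2 ^ suc L
  grow L 3≤L hyp = begin
    c * (suc L * suc L) ≤⟨ *-monoʳ-≤ c (square-step L 3≤L) ⟩
    c * (2 * (L * L))   ≡⟨ solve 2 (λ c x → c :* (con 2 :* x) := con 2 :* (c :* x)) refl c (L * L) ⟩
    2 * (c * (L * L))   ≤⟨ *-monoʳ-≤ 2 hyp ⟩
    2 ^ suc L           ∎

  go : ∀ L → a + a ≤ L → c * (L * L) ≤ 2 ^ L
  go L L₀≤L with a + a ℕ.≟ L
  ... | yes refl = base
  go (suc L) L₀≤L | no L₀≢L = grow L (≤-trans (s≤s (s≤s (s≤s z≤n))) L₀≤L′) (go L L₀≤L′)
    where
    L₀≤L′ : a + a ≤ L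
    L₀≤L′ = ℕ.≤-pred (ℕ.≤∧≢⇒< L₀≤L L₀≢L)

exponent<nC2 : ∀ e k n L → 2 * (e + k) + 8 * k * (L * L) + 1 < n → e + (k + L * 4 * L * n * k) < n C 2
exponent<nC2 e k n@(suc _) L Q<n =
  ℕ.*-cancelˡ-< 2 _ _ (ℕ.+-cancelʳ-< n _ _ (subst (2 * E + n <_) (sym (2*nC2+n≡n*n n)) 2E+n<n*n))
  where
  E = e + (k + L * 4 * L * n * k)
  open ℕ.≤-Reasoning
  2E+n<n*n : 2 * E + n < n * n
  2E+n<n*n = begin-strict
    2 * E + n
      ≡⟨ solve 4 (λ e k n L → con 2 :* (e :+ (k :+ L :* con 4 :* L :* n :* k)) :+ n
                            := con 2 :* (e :+ k) :+ n :* (con 8 :* k :* (L :* L)) :+ n) refl e k n L ⟩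
    2 * (e + k) + n * (8 * k * (L * L)) + n
      ≤⟨ ℕ.+-monoˡ-≤ n (ℕ.+-monoˡ-≤ (n * (8 * k * (L * L))) (ℕ.m≤n*m (2 * (e + k)) n)) ⟩
    n * (2 * (e + k)) + n * (8 * k * (L * L)) + n
      ≡⟨ solve 4 (λ e k n L → n :* (con 2 :* (e :+ k)) :+ n :* (con 8 :* k :* (L :* L)) :+ n
                            := n :* (con 2 :* (e :+ k) :+ con 8 :* k :* (L :* L) :+ con 1)) refl e k n L ⟩
    n * (2 * (e + k) + 8 * k * (L * L) + 1)
      <⟨ ℕ.*-monoʳ-< n Q<n ⟩
    n * n ∎

codes≤2^ : ∀ e k n L → suc n ≤ 2 ^ L →
           suc e * (suc k * (((labelCount n ^ L) ^ n) ^ k)) ≤ 2 ^ (e + (k + L * 4 * L * n * k))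
codes≤2^ e k n L n<2^L = begin
  suc e * (suc k * (((labelCount n ^ L) ^ n) ^ k))
    ≤⟨ *-mono-≤ (n<2^n e) (*-mono-≤ (n<2^n k) (ℕ.^-monoˡ-≤ k (ℕ.^-monoˡ-≤ n (ℕ.^-monoˡ-≤ L labels≤)))) ⟩
  2 ^ e * (2 ^ k * ((((2 ^ (L * 4)) ^ L) ^ n) ^ k))
    ≡⟨ cong (λ x → 2 ^ e * (2 ^ k * x)) powers≡ ⟩
  2 ^ e * (2 ^ k * 2 ^ (L * 4 * L * n * k))
    ≡⟨ trans (ℕ.^-distribˡ-+-* 2 e _) (cong (2 ^ e *_) (ℕ.^-distribˡ-+-* 2 k _)) ⟨
  2 ^ (e + (k + L * 4 * L * n * k)) ∎
  where
  open ℕ.≤-Reasoning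

  powers≡ : (((2 ^ (L * 4)) ^ L) ^ n) ^ k ≡ 2 ^ (L * 4 * L * n * k)
  powers≡ = trans (cong (λ x → (x ^ n) ^ k) (ℕ.^-*-assoc 2 (L * 4) L))
                  (trans (cong (_^ k) (ℕ.^-*-assoc 2 (L * 4 * L) n)) (ℕ.^-*-assoc 2 (L * 4 * L * n) k))

  labels≤ : labelCount n ≤ 2 ^ (L * 4)
  labels≤ = begin
    n * (suc n * (suc n * suc n))     ≤⟨ *-mono-≤ (ℕ.<⇒≤ n<2^L) (*-mono-≤ n<2^L (*-mono-≤ n<2^L n<2^L)) ⟩
    2 ^ L * (2 ^ L * (2 ^ L * 2 ^ L)) ≡⟨ solve 1 (λ p → p :* (p :* (p :* p)) := p :^ 4) refl (2 ^ L) ⟩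
    (2 ^ L) ^ 4                       ≡⟨ ℕ.^-*-assoc 2 L 4 ⟩
    2 ^ (L * 4)                       ∎

per-vertex-exponent<n : ∀ e k n L → 1 ≤ L → (4 * (e + k) + 16 * k + 3) * (L * L) ≤ 2 ^ L → 2 ^ L ≤ 2 * n →
                        2 * (e + k) + 8 * k * (L * L) + 1 < n
per-vertex-exponent<n e k n L 1≤L c*L²≤2^L 2^L≤2n = ℕ.*-cancelˡ-< 2 _ _ (begin-strict
  2 * (2 * (e + k) + 8 * k * (L * L) + 1)
    ≡⟨ solve 3 (λ e k x → con 2 :* (con 2 :* (e :+ k) :+ con 8 :* k :* x :+ con 1)
                        := (con 4 :* (e :+ k) :+ con 2) :* con 1 :+ con 16 :* k :* x) refl e k (L * L) ⟩
  (4 * (e + k) + 2) * 1 + 16 * k * (L * L)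
    ≤⟨ ℕ.+-monoˡ-≤ (16 * k * (L * L)) (*-monoʳ-≤ (4 * (e + k) + 2) 1≤L²) ⟩
  (4 * (e + k) + 2) * (L * L) + 16 * k * (L * L)
    <⟨ ℕ.m<m+n _ 1≤L² ⟩
  (4 * (e + k) + 2) * (L * L) + 16 * k * (L * L) + L * L
    ≡⟨ solve 3 (λ e k x → (con 4 :* (e :+ k) :+ con 2) :* x :+ con 16 :* k :* x :+ x
                        := (con 4 :* (e :+ k) :+ con 16 :* k :+ con 3) :* x) refl e k (L * L) ⟩
  (4 * (e + k) + 16 * k + 3) * (L * L)
    ≤⟨ c*L²≤2^L ⟩
  2 ^ L
    ≤⟨ 2^L≤2n ⟩
  2 * n ∎)
  where
  open ℕ.≤-Reasoning
  1≤L² : 1 ≤ L * L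
  1≤L² = *-mono-≤ 1≤L 1≤L

codes<2^[nC2] : ∀ e k n L → suc n < 2 ^ L → 2 ^ L ≤ 2 * suc n → (4 * (e + k) + 16 * k + 3) * (L * L) ≤ 2 ^ L →
                suc e * (suc k * (((labelCount (suc n) ^ L) ^ suc n) ^ k)) < 2 ^ (suc n C 2)
codes<2^[nC2] e k n L n<2^L 2^L≤2n c*L²≤2^L =
  ≤-<-trans (codes≤2^ e k (suc n) L n<2^L)
            (ℕ.^-monoʳ-< 2 (s≤s (s≤s z≤n)) (exponent<nC2 e k (suc n) L per-vertex<n))
  where
  exponent-positive : ∀ {L} → suc n < 2 ^ L → 1 ≤ L
  exponent-positive {zero}  (s≤s ())
  exponent-positive {suc _} _ = s≤s z≤n

  per-vertex<n : 2 * (e + k) + 8 * k * (L * L) + 1 < suc n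
  per-vertex<n = per-vertex-exponent<n e k (suc n) L (exponent-positive n<2^L) c*L²≤2^L 2^L≤2n

corollary12 : (k : ℕ) → 1 ≤ k → (e : ℕ) →
    Σ ℕ λ N → (n : ℕ) → N ≤ n → (Gs : List (Graph n)) → DistinctMembers n k Gs →
      suc e * length Gs < 2 ^ (n C 2)
corollary12 k _ e = 2 ^ L₀ , bound
  where
  c : ℕ
  c = 4 * (e + k) + 16 * k + 3

  L₀ : ℕ
  L₀ = proj₁ (eventually-c*L²≤2^L c)

  bound : (n : ℕ) → 2 ^ L₀ ≤ n → (Gs : List (Graph n)) → DistinctMembers n k Gs → suc e * length Gs < 2 ^ (n C 2)
  bound zero    2^L₀≤0 _  _       = contradiction 2^L₀≤0 (<⇒≱ (ℕ.m^n>0 2 L₀))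
  bound (suc n) 2^L₀≤n Gs members with log₂-bracket n
  ... | L , n<2^L , 2^L≤2n = begin-strict
    suc e * length Gs
      ≤⟨ *-monoʳ-≤ (suc e) few ⟩
    suc e * (suc k * (((labelCount (suc n) ^ L) ^ suc n) ^ k))
      <⟨ codes<2^[nC2] e k n L n<2^L 2^L≤2n (proj₂ (eventually-c*L²≤2^L c) L₀≤L) ⟩
    2 ^ (suc n C 2) ∎
    where
    open ℕ.≤-Reasoning
    L₀≤L : L₀ ≤ L
    L₀≤L = ≮⇒≥ λ L<L₀ → <⇒≱ n<2^L (≤-trans (ℕ.^-monoʳ-≤ 2 (ℕ.<⇒≤ L<L₀)) 2^L₀≤n)
    few : length Gs ≤ suc k * (((labelCount (suc n) ^ L) ^ suc n) ^ k)
    few = few-thresholdPCGs k L Gs (≤-trans n<2^L (ℕ.m≤m+n (2 ^ L) _)) members
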